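{- For every signed permutation $\pi\in B_n$ with $\operatorname{fwex}(\pi)=k$, we have $2\operatorname{cro}(\pi)+\operatorname{al}(\pi)=n^2-2n+k$.
   Context: $B_n$ is the set of signed permutations of $[n]$; $\pi\in B_n$ is viewed as a bijection of $[\pm n]=\{\pm1,\dots,\pm n\}$ with $\pi(i)=\pi_i$ and $\pi(-i)=-\pi_i$. $\operatorname{wex}(\pi)=\#\{i\in[n]:\pi_i\ge i\}$, $\operatorname{neg}(\pi)=\#\{i\in[n]:\pi_i<0\}$, $\operatorname{fwex}(\pi)=2\operatorname{wex}(\pi)+\operatorname{neg}(\pi)$. A crossing of $\pi$ is a pair $(i,j)$ with $i,j\in[n]$ such that $i<j\le\pi_i<\pi_j$, or $-i<j\le-\pi_i<\pi_j$, or $i>j>\pi_i>\pi_j$; $\operatorname{cro}(\pi)$ is their number. Full pignose diagram: place $2n$ "pignoses" on a horizontal line, labeled $-n,\dots,-1,1,\dots,n$ from left to right, each consisting of two consecutive vertices (so $4n$ vertices in total). For a pignose labeled $i>0$ its first vertex is its left vertex and its second vertex is its right vertex; for $i<0$ its first vertex is its right vertex and its second vertex is its left vertex. For each $i\in[\pm n]$ draw an arc joining the first vertex of pignose $i$ to the second vertex of pignose $\pi(i)$; the arc is drawn above the line (an upper arc) if the second-vertex endpoint lies to the right of the first-vertex endpoint, and below the line (a lower arc) otherwise. An alignment is an unordered pair of arcs whose four endpoints are at positions $p_1<p_2<p_3<p_4$ such that either (a) both arcs are upper, or both are lower, and they join $\{p_1,p_4\}$ and $\{p_2,p_3\}$;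 or (b) they join $\{p_1,p_2\}$ and $\{p_3,p_4\}$ and exactly one of them is an upper arc. $\operatorname{al}(\pi)$ is the number of alignments. -}

module Defs where

open import Data.Bool using (Bool; true; false; if_then_else_; _∧_; _∨_; not; _xor_)
open import Data.Nat using (ℕ) renaming (_+_ to _+ℕ_; _*_ to _*ℕ_)
open import Data.Fin using (Fin; toℕ)
open import Data.Fin.Permutation using (Permutation′; _⟨$⟩ʳ_)
open import Data.Integer using (ℤ; +_; -_; _+_; _-_; _*_; _<?_; _≤?_)
open import Data.List using (List; length; filterᵇ; allFin; map; _++_; concatMap)
open import Data.Product using (_×_; _,_; proj₁; proj₂)
open import Relation.Nullary.Decidable using (⌊_⌋)

-- A signed permutation π ∈ B_n : π_i = ε_i · σ(i) with σ ∈ S_n and signs ε_i.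
-- (index i : Fin n stands for i+1 ∈ [n]; negative i true means ε_i = -1)
record SignedPerm (n : ℕ) : Set where
  field
    perm     : Permutation′ n
    negative : Fin n → Bool
open SignedPerm public

count : {A : Set} → (A → Bool) → List A → ℕ
count p xs = length (filterᵇ p xs)

_<ᵇ_ : ℤ → ℤ → Bool
x <ᵇ y = ⌊ x <? y ⌋

_≤ᵇ_ : ℤ → ℤ → Bool
x ≤ᵇ y = ⌊ x ≤? y ⌋

pos : {n : ℕ} → Fin n → ℤ
pos i = + (1 +ℕ toℕ i)

val : {n : ℕ} → SignedPerm n → Fin n → ℤ
val π i = if negative π i then - pos (perm π ⟨$⟩ʳ i) else pos (perm π ⟨$⟩ʳ i)

-- Labels in [±n]: (s , i) is -(i+1) if s = true, and +(i+1) if s = false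
Label : ℕ → Set
Label n = Bool × Fin n

labelℤ : {n : ℕ} → Label n → ℤ
labelℤ (s , i) = if s then - pos i else pos i

labels : (n : ℕ) → List (Label n)
labels n = map (λ i → (true , i)) (allFin n) ++ map (λ i → (false , i)) (allFin n)

apply : {n : ℕ} → SignedPerm n → Label n → Label n
apply π (s , i) = (s xor negative π i , perm π ⟨$⟩ʳ i)

wex : {n : ℕ} → SignedPerm n → ℕ
wex {n} π = count (λ i → pos i ≤ᵇ val π i) (allFin n)

neg : {n : ℕ} → SignedPerm n → ℕ
neg {n} π = count (λ i → negative π i) (allFin n)

fwex : {n : ℕ} → SignedPerm n → ℕ
fwex π = 2 *ℕ wex π +ℕ neg π

pairs : {A : Set} → List A → List (A × A)
pairs xs = concatMap (λ x → map (λ y → (x , y)) xs) xs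

isCrossing : {n : ℕ} → SignedPerm n → Fin n × Fin n → Bool
isCrossing π (i , j) =
  let I = pos i ; J = pos j ; Pi = val π i ; Pj = val π j in
     (I <ᵇ J ∧ J ≤ᵇ Pi ∧ Pi <ᵇ Pj)
  ∨ ((- I) <ᵇ J ∧ J ≤ᵇ (- Pi) ∧ (- Pi) <ᵇ Pj)
  ∨ (J <ᵇ I ∧ Pi <ᵇ J ∧ Pj <ᵇ Pi)

cro : {n : ℕ} → SignedPerm n → ℕ
cro {n} π = count (isCrossing π) (pairs (allFin n))

-- Pignoses labelled -n,…,-1,1,…,n from left to right;
-- the pignose with label l occupies vertex positions 2·idx(l) and 2·idx(l)+1,
-- where idx(l) = l + n for l < 0 and idx(l) = l + n - 1 for l > 0.
pigIdx : {n : ℕ} → Label n → ℤ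
pigIdx {n} (true  , i) = (- pos i) + + n
pigIdx {n} (false , i) = pos i + + n - + 1

leftV rightV : {n : ℕ} → Label n → ℤ
leftV  l = + 2 * pigIdx l
rightV l = + 2 * pigIdx l + + 1

firstV secondV : {n : ℕ} → Label n → ℤ
firstV  l@(s , _) = if s then rightV l else leftV l
secondV l@(s , _) = if s then leftV l else rightV l

record Arc : Set where
  constructor arc
  field
    start : ℤ
    end   : ℤ

arcOf : {n : ℕ} → SignedPerm n → Label n → Arc
arcOf π l = arc (firstV l) (secondV (apply π l))

upper : Arc → Bool
upper (arc a b) = a <ᵇ b

lo hi : Arc → ℤ
lo (arc a b) = if a <ᵇ b then a else b
hi (arc a b) = if a <ᵇ b then b else a

_==ᵇ_ : Bool → Bool → Bool
x ==ᵇ y = not (x xor y)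

-- alignment of two arcs (endpoints p1<p2<p3<p4):
-- (a) same type and they join {p1,p4},{p2,p3} (one nested in the other), or
-- (b) they join {p1,p2},{p3,p4} and exactly one is upper.
isAlignment : Arc → Arc → Bool
isAlignment A B =
     ((upper A ==ᵇ upper B) ∧
        ((lo A <ᵇ lo B ∧ hi B <ᵇ hi A) ∨ (lo B <ᵇ lo A ∧ hi A <ᵇ hi B)))
  ∨  ((upper A xor upper B) ∧ (hi A <ᵇ lo B ∨ hi B <ᵇ lo A))

-- unordered pairs of arcs, each counted once (l < l' as integers)
al : {n : ℕ} → SignedPerm n → ℕ
al {n} π = count (λ { (l , l') → labelℤ l <ᵇ labelℤ l' ∧ isAlignment (arcOf π l) (arcOf π l') })
                 (pairs (labels n))

module Submission where

-- Let W(i , j) be twice the indicator that (i , j) is a crossing plus the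
-- number of alignments between the arcs of ±i and ±j, so that
-- 2 cro + al = Σ_{i,j} W(i , j). W(i , j) depends only on the signs of π_i and
-- π_j and on the relative order of i, j, |π_i|, |π_j|; replacing these four
-- numbers by their ranks leaves finitely many cases, and checking all of them
-- gives W(i , j) = R(i , j) + C(i , j) for explicit R and C built from the same
-- comparisons. Counting indices from 0, R(i , j) sums over j to
-- 2i - |π_i| + [π_i > 0] - 2[0 < π_i < i], and C(i , j) sums over i to j.
-- As Σ |π_i| = Σ i = (n² - n)/2 and [π_i > 0] - 2[0 < π_i < i] equals
-- 2[i ≤ π_i] + [π_i < 0] - 1, the total is n² - n + 2 wex + neg - n.

open import Data.Bool using (Bool; true; false; T; not; _∧_; _∨_; _xor_; if_then_else_)
open import Data.Bool.Properties using (not-involutive; ∧-comm)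
open import Data.Empty using (⊥-elim)
open import Data.Fin using (Fin; zero; suc; toℕ; fromℕ; fromℕ<; inject₁; _≟_)
import Data.Fin.Properties as Finₚ
open import Data.Fin.Patterns using (0F; 1F; 2F; 3F)
open import Data.Fin.Permutation using (Permutation′; _⟨$⟩ʳ_; _⟨$⟩ˡ_; inverseˡ)
open import Data.Integer as ℤ using (ℤ; -1ℤ; +_; -[1+_]; -_; _+_; _-_; _*_; _<_; _≤?_; _<?_)
import Data.Integer.Properties as ℤₚ
open import Data.Integer.Tactic.RingSolver using (solve-∀)
open import Data.List using (List; []; _∷_; _++_; map; concatMap; tabulate; allFin)
open import Data.List.Membership.Propositional using (_∈_)
open import Data.List.Membership.Propositional.Properties using (∈-allFin)
open import Data.List.Relation.Unary.Any using (here; there)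
open import Data.Nat as ℕ using (ℕ; zero; suc; z≤n; s≤s)
import Data.Nat.Properties as ℕₚ
open import Data.Product using (_×_; _,_; proj₁)
open import Data.Sum using (_⊎_; inj₁; inj₂; [_,_])
open import Data.Vec as Vec using (Vec)
open import Data.Vec.Properties using (tabulate-cong)
open import Function using (_∘_; _⇔_; mk⇔)
open import Relation.Binary.PropositionalEquality using (_≡_; refl; sym; trans; cong; cong₂; subst; subst₂; module ≡-Reasoning)
open import Relation.Nullary using (¬_; Dec; yes; no; does; ¬?; _×-dec_; _⊎-dec_; _→-dec_; T?)
open import Relation.Nullary.Decidable using (isYes; isYes≗does; does-⇔; from-yes; map′)
open import Defs
open import Algebra.Properties.Semiring.Sum ℤₚ.+-*-semiring
  using (sum; sum-syntax; sum-cong-≗; sum-replicate-zero; sum-init-last; ∑-distrib-+; ∑-comm; ∑-permute; *-distribˡ-sum)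

open ≡-Reasoning

𝟙 : Bool → ℤ
𝟙 true  = + 1
𝟙 false = + 0

isYes-⇔ : {A B : Set} → A ⇔ B → (a? : Dec A) (b? : Dec B) → isYes a? ≡ isYes b?
isYes-⇔ A⇔B a? b? = trans (isYes≗does a?) (trans (does-⇔ A⇔B a? b?) (sym (isYes≗does b?)))

∀-Bool? : {P : Bool → Set} → ((b : Bool) → Dec (P b)) → Dec ((b : Bool) → P b)
∀-Bool? P? = map′ (λ (p , q) → λ { true → p ; false → q }) (λ f → f true , f false) (P? true ×-dec P? false)

∑ₗ : {A : Set} → List A → (A → ℤ) → ℤ
∑ₗ []       f = + 0
∑ₗ (x ∷ xs) f = f x + ∑ₗ xs f

count≡∑ₗ : {A : Set} (p : A → Bool) (xs : List A) → + count p xs ≡ ∑ₗ xs (𝟙 ∘ p)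
count≡∑ₗ p [] = refl
count≡∑ₗ p (x ∷ xs) with p x
... | true  = cong (_+_ (+ 1)) (count≡∑ₗ p xs)
... | false = trans (count≡∑ₗ p xs) (sym (ℤₚ.+-identityˡ _))

∑ₗ-++ : {A : Set} (xs ys : List A) (f : A → ℤ) → ∑ₗ (xs ++ ys) f ≡ ∑ₗ xs f + ∑ₗ ys f
∑ₗ-++ []       ys f = sym (ℤₚ.+-identityˡ _)
∑ₗ-++ (x ∷ xs) ys f = trans (cong (λ z → f x + z) (∑ₗ-++ xs ys f)) (sym (ℤₚ.+-assoc (f x) _ _))

∑ₗ-map : {A B : Set} (g : A → B) (xs : List A) (f : B → ℤ) → ∑ₗ (map g xs) f ≡ ∑ₗ xs (f ∘ g)
∑ₗ-map g []       f = refl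
∑ₗ-map g (x ∷ xs) f = cong (λ z → f (g x) + z) (∑ₗ-map g xs f)

∑ₗ-pairs : {A : Set} (xs : List A) (f : A × A → ℤ) → ∑ₗ (pairs xs) f ≡ ∑ₗ xs (λ x → ∑ₗ xs (λ y → f (x , y)))
∑ₗ-pairs xs f = go xs
  where
  go : ∀ zs → ∑ₗ (concatMap (λ x → map (x ,_) xs) zs) f ≡ ∑ₗ zs (λ x → ∑ₗ xs (λ y → f (x , y)))
  go []       = refl
  go (z ∷ zs) = trans (∑ₗ-++ (map (z ,_) xs) _ f) (cong₂ _+_ (∑ₗ-map (z ,_) xs f) (go zs))

∑ₗ-tabulate : {A : Set} {n : ℕ} (g : Fin n → A) (f : A → ℤ) → ∑ₗ (tabulate g) f ≡ ∑[ i < n ] f (g i)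
∑ₗ-tabulate {n = zero}  g f = refl
∑ₗ-tabulate {n = suc n} g f = cong (λ z → f (g zero) + z) (∑ₗ-tabulate (g ∘ suc) f)

∑ₗ-labels : {n : ℕ} (f : Label n → ℤ) → ∑ₗ (labels n) f ≡ ∑[ i < n ] (f (true , i) + f (false , i))
∑ₗ-labels {n} f = begin
  ∑ₗ (labels n) f
    ≡⟨ ∑ₗ-++ (map (true ,_) (allFin n)) _ f ⟩
  ∑ₗ (map (true ,_) (allFin n)) f + ∑ₗ (map (false ,_) (allFin n)) f
    ≡⟨ cong₂ _+_ (trans (∑ₗ-map (true ,_) (allFin n) f) (∑ₗ-tabulate (λ i → i) (λ i → f (true , i))))
                 (trans (∑ₗ-map (false ,_) (allFin n) f) (∑ₗ-tabulate (λ i → i) (λ i → f (false , i)))) ⟩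
  ∑[ i < n ] f (true , i) + ∑[ i < n ] f (false , i)
    ≡⟨ ∑-distrib-+ (λ i → f (true , i)) (λ i → f (false , i)) ⟨
  ∑[ i < n ] (f (true , i) + f (false , i)) ∎

∑-scale-+ : {n : ℕ} (a : ℤ) (f g : Fin n → ℤ) → ∑[ i < n ] (a * f i + g i) ≡ a * sum f + sum g
∑-scale-+ a f g = trans (∑-distrib-+ (λ i → a * f i) g) (cong (λ z → z + sum g) (sym (*-distribˡ-sum a f)))

∑-linear : {n : ℕ} (a b : ℤ) (f g : Fin n → ℤ) → ∑[ i < n ] (a * f i + b * g i) ≡ a * sum f + b * sum g
∑-linear a b f g = trans (∑-scale-+ a f _) (cong (λ z → a * sum f + z) (sym (*-distribˡ-sum b g)))

∑-const : (n : ℕ) (c : ℤ) → ∑[ i < n ] c ≡ + n * c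
∑-const zero    c = sym (ℤₚ.*-zeroˡ c)
∑-const (suc n) c = trans (cong (λ z → c + z) (∑-const n c)) (lemma c (+ n))
  where lemma : ∀ c m → c + m * c ≡ (+ 1 + m) * c
        lemma = solve-∀

not-<ᵇ : ∀ m k → not (m ℕ.<ᵇ k) ≡ (k ℕ.<ᵇ suc m)
not-<ᵇ zero    zero    = refl
not-<ᵇ zero    (suc k) = refl
not-<ᵇ (suc m) zero    = refl
not-<ᵇ (suc m) (suc k) = not-<ᵇ m k

∑-below : {n : ℕ} (m : ℕ) → m ℕ.≤ n → ∑[ j < n ] 𝟙 (toℕ j ℕ.<ᵇ m) ≡ + m
∑-below {n} zero    _         = sum-replicate-zero n
∑-below     (suc m) (s≤s m≤n) = cong (_+_ (+ 1)) (∑-below m m≤n)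

∑-atMost : {n : ℕ} (m : ℕ) → m ℕ.< n → ∑[ j < n ] 𝟙 (not (m ℕ.<ᵇ toℕ j)) ≡ + suc m
∑-atMost {n} m m<n = trans (sum-cong-≗ {n} {x = λ j → 𝟙 (not (m ℕ.<ᵇ toℕ j))} (cong 𝟙 ∘ not-<ᵇ m ∘ toℕ)) (∑-below (suc m) m<n)

module _ {n : ℕ} (σ : Permutation′ n) where

  ∑-below-permuted : (m : ℕ) → m ℕ.≤ n → ∑[ j < n ] 𝟙 (toℕ (σ ⟨$⟩ʳ j) ℕ.<ᵇ m) ≡ + m
  ∑-below-permuted m m≤n = trans (sym (∑-permute _ σ)) (∑-below m m≤n)

double-∑-toℕ : (n : ℕ) → + 2 * (∑[ i < n ] (+ toℕ i)) ≡ + n * + n - + n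
double-∑-toℕ zero    = refl
double-∑-toℕ (suc n) = begin
  + 2 * (∑[ i < suc n ] (+ toℕ i))
    ≡⟨ cong (_*_ (+ 2)) (sum-init-last {n} (λ i → + toℕ i)) ⟩
  + 2 * (∑[ i < n ] (+ toℕ (inject₁ i)) + + toℕ (fromℕ n))
    ≡⟨ cong₂ (λ s l → + 2 * (s + + l)) (sum-cong-≗ {n} (cong +_ ∘ Finₚ.toℕ-inject₁)) (Finₚ.toℕ-fromℕ n) ⟩
  + 2 * (∑[ i < n ] (+ toℕ i) + + n)
    ≡⟨ step (∑[ i < n ] (+ toℕ i)) (+ n) (double-∑-toℕ n) ⟩
  (+ 1 + + n) * (+ 1 + + n) - (+ 1 + + n) ∎
  where
  step : ∀ s m → + 2 * s ≡ m * m - m → + 2 * (s + m) ≡ (+ 1 + m) * (+ 1 + m) - (+ 1 + m)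
  step s m eq = trans (distrib s m) (trans (cong (λ z → z + + 2 * m) eq) (expand m))
    where distrib : ∀ s m → + 2 * (s + m) ≡ + 2 * s + + 2 * m
          distrib = solve-∀
          expand : ∀ m → m * m - m + + 2 * m ≡ (+ 1 + m) * (+ 1 + m) - (+ 1 + m)
          expand = solve-∀

-- (true , x) is the label -(x+1) and (false , x) the label x+1; the vertex
-- (l , e) is the right (e = true) or left vertex of pignose l. Written with
-- if_then_else_ rather than by matching on the signs, so that instances at
-- different carriers whose comparisons agree are definitionally equal.
module SignedOrder {X : Set} (_≺_ : X → X → Bool) where

  infix 7 _⊏_ _⊑_ _◁_

  _⊏_ _⊑_ : Bool × X → Bool × X → Bool
  (s , x) ⊏ (t , y) = if s then (if t then y ≺ x else true) else (if t then false else x ≺ y)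
  l ⊑ l′ = not (l′ ⊏ l)

  _◁_ : (Bool × X) × Bool → (Bool × X) × Bool → Bool
  (l , e) ◁ (l′ , f) = l ⊏ l′ ∨ (l ⊑ l′ ∧ not e ∧ f)

isAlignmentBy : {X : Set} → (X → X → Bool) → X × X → X × X → Bool
isAlignmentBy {X} _≺_ A B =
     ((upper′ A ==ᵇ upper′ B) ∧
        ((lo′ A ≺ lo′ B ∧ hi′ B ≺ hi′ A) ∨ (lo′ B ≺ lo′ A ∧ hi′ A ≺ hi′ B)))
  ∨  ((upper′ A xor upper′ B) ∧ (hi′ A ≺ lo′ B ∨ hi′ B ≺ lo′ A))
  where
  upper′ : X × X → Bool
  upper′ (a , b) = a ≺ b
  lo′ hi′ : X × X → X
  lo′ (a , b) = if a ≺ b then a else b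
  hi′ (a , b) = if a ≺ b then b else a

Order : Set
Order = Fin 4 → Fin 4 → Bool

orderOn : {X : Set} → (X → X → Bool) → (Fin 4 → X) → Order
orderOn _≺_ v x y = v x ≺ v y

ltFin : {n : ℕ} → Fin n → Fin n → Bool
ltFin x y = toℕ x ℕ.<ᵇ toℕ y

quad : {A : Set} → A → A → A → A → Fin 4 → A
quad a b c d 0F = a
quad a b c d 1F = b
quad a b c d 2F = c
quad a b c d 3F = d

-- A function of an order that queries it only at the constants 0F … 3F cannot
-- tell o from lookupOrder (tabulateOrder o): they are definitionally equal
-- there. With tabulateOrder-cong, such functions therefore respect pointwise
-- equality of orders.
tabulateOrder : Order → Vec (Vec Bool 4) 4
tabulateOrder o = Vec.tabulate λ x → Vec.tabulate (o x)

lookupOrder : Vec (Vec Bool 4) 4 → Order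
lookupOrder T x y = Vec.lookup (Vec.lookup T x) y

tabulateOrder-cong : {o o′ : Order} → (∀ x y → o x y ≡ o′ x y) → tabulateOrder o ≡ tabulateOrder o′
tabulateOrder-cong o≗o′ = tabulate-cong λ x → tabulate-cong (o≗o′ x)

-- Whether the arcs (0F , 1F) and (2F , 3F) form an alignment, by cases on their
-- orientations so that the order of the endpoints is only queried at constants.
alignment : Order → Bool
alignment o =
  if o 0F 1F then (if o 2F 3F then oriented true  true  0F 1F 2F 3F else oriented true  false 0F 1F 3F 2F)
             else (if o 2F 3F then oriented false true  1F 0F 2F 3F else oriented false false 1F 0F 3F 2F)
  where
  oriented : Bool → Bool → Fin 4 → Fin 4 → Fin 4 → Fin 4 → Bool
  oriented u v l₁ h₁ l₂ h₂ =
       ((u ==ᵇ v) ∧ ((o l₁ l₂ ∧ o h₂ h₁) ∨ (o l₂ l₁ ∧ o h₁ h₂)))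
    ∨  ((u xor v) ∧ (o h₁ l₂ ∨ o h₂ l₁))

isAlignmentBy≡alignment : {X : Set} (_≺_ : X → X → Bool) (a b c d : X) →
  isAlignmentBy _≺_ (a , b) (c , d) ≡ alignment (orderOn _≺_ (quad a b c d))
isAlignmentBy≡alignment _≺_ a b c d with a ≺ b | c ≺ d
... | true  | true  = refl
... | true  | false = refl
... | false | true  = refl
... | false | false = refl

alignment-cong : {o o′ : Order} → (∀ x y → o x y ≡ o′ x y) → alignment o ≡ alignment o′
alignment-cong o≗o′ = cong (alignment ∘ lookupOrder) (tabulateOrder-cong o≗o′)

-- The contribution of a pair of indices, from the order of i, j, |π i|, |π j|

-- The points of an order are I = i, J = j, πI = |π i|, πJ = |π j|; s and t
-- are the signs of π i and π j (true when negative).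
pattern I  = 0F
pattern J  = 1F
pattern πI = 2F
pattern πJ = 3F

module PairStatistics (o : Order) (s t : Bool) where
  open SignedOrder o

  crossing : Bool
  crossing =
       (false , I) ⊏ (false , J) ∧ (false , J) ⊑ (s , πI) ∧ (s , πI) ⊏ (t , πJ)
     ∨ (true , I) ⊏ (false , J) ∧ (false , J) ⊑ (not s , πI) ∧ (not s , πI) ⊏ (t , πJ)
     ∨ (false , J) ⊏ (false , I) ∧ (s , πI) ⊏ (false , J) ∧ (t , πJ) ⊏ (s , πI)

  aligned : Bool → Bool → Bool
  aligned ε δ =
    (ε , I) ⊏ (δ , J) ∧
    alignment (orderOn _◁_ (quad (first ε I) (second (ε xor s) πI) (first δ J) (second (δ xor t) πJ)))
    where
    first second : Bool → Fin 4 → (Bool × Fin 4) × Bool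
    first  u x = ((u , x) , u)
    second u x = ((u , x) , not u)

  weight : ℤ
  weight = + 2 * 𝟙 crossing
         + ((𝟙 (aligned true true) + 𝟙 (aligned true false)) + (𝟙 (aligned false true) + 𝟙 (aligned false false)))

open PairStatistics using (crossing; aligned; weight)

rowTerm : Order → Bool → ℤ
rowTerm o s = + 2 * 𝟙 (o J I) - 𝟙 (o πJ πI)
            + 𝟙 (not s) * (𝟙 (not (o I J)) - 𝟙 (o J I))
            + + 2 * 𝟙 (not s ∧ o πI I) * (𝟙 (o πJ πI) - 𝟙 (not (o πI J)))

colTerm : Order → Bool → ℤ
colTerm o t = 𝟙 (o I J) + + 2 * 𝟙 (not t ∧ not (o πJ J)) * (𝟙 (o I J) - 𝟙 (o πI J))

localWeight : Order → Bool → Bool → ℤ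
localWeight o s t = rowTerm o s + colTerm o t

tied : Order → Fin 4 → Fin 4 → Bool
tied o x y = not (o x y ∨ o y x)

-- Orders that can arise from a pair: i = j exactly when |π i| = |π j|, and
-- then the signs agree.
admissible : Order → Bool → Bool → Bool
admissible o s t = if tied o I J then tied o πI πJ ∧ (s ==ᵇ t) else not (tied o πI πJ)

LocalIdentity : Order → Bool → Bool → Set
LocalIdentity o s t = T (admissible o s t) → weight o s t ≡ localWeight o s t

-- Decided by evaluation: 4⁴ rank vectors and 4 pairs of signs.
local-identity-on-ranks : ∀ (a b c d : Fin 4) s t → LocalIdentity (orderOn ltFin (quad a b c d)) s t
local-identity-on-ranks = from-yes decision
  where
  decision : Dec (∀ (a b c d : Fin 4) s t → LocalIdentity (orderOn ltFin (quad a b c d)) s t)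
  decision =
    Finₚ.all? λ a → Finₚ.all? λ b → Finₚ.all? λ c → Finₚ.all? λ d → ∀-Bool? λ s → ∀-Bool? λ t →
    let o = orderOn ltFin (quad a b c d) in
    T? (admissible o s t) →-dec weight o s t ℤ.≟ localWeight o s t

-- Reduction to ranks

count-mono : {A : Set} {p q : A → Bool} → (∀ x → T (p x) → T (q x)) → ∀ xs → count p xs ℕ.≤ count q xs
count-mono p⇒q [] = z≤n
count-mono {p = p} {q} p⇒q (x ∷ xs) with p x | q x | p⇒q x
... | true  | true  | _   = s≤s (count-mono p⇒q xs)
... | true  | false | p⇒q = ⊥-elim (p⇒q _)
... | false | true  | _   = ℕₚ.m≤n⇒m≤1+n (count-mono p⇒q xs)
... | false | false | _   = count-mono p⇒q xs

count-mono-< : {A : Set} {p q : A → Bool} → (∀ x → T (p x) → T (q x)) →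
  ∀ {x xs} → x ∈ xs → ¬ T (p x) → T (q x) → count p xs ℕ.< count q xs
count-mono-< {p = p} {q} p⇒q {x} {_ ∷ xs} (here refl) ¬px qx with p x | q x
... | true  | _     = ⊥-elim (¬px _)
... | false | false = ⊥-elim qx
... | false | true  = s≤s (count-mono p⇒q xs)
count-mono-< {p = p} {q} p⇒q {xs = y ∷ _} (there x∈xs) ¬px qx with p y | q y | p⇒q y
... | true  | true  | _   = s≤s (count-mono-< p⇒q x∈xs ¬px qx)
... | true  | false | p⇒q = ⊥-elim (p⇒q _)
... | false | true  | _   = ℕₚ.m≤n⇒m≤1+n (count-mono-< p⇒q x∈xs ¬px qx)
... | false | false | _   = count-mono-< p⇒q x∈xs ¬px qx

<ᵇ-irrefl : ∀ m → ¬ T (m ℕ.<ᵇ m)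
<ᵇ-irrefl m = ℕₚ.<-irrefl refl ∘ ℕₚ.<ᵇ⇒< m m

rank : (Fin 4 → ℕ) → Fin 4 → ℕ
rank v x = count (λ y → v y ℕ.<ᵇ v x) (allFin 4)

rank<4 : (v : Fin 4 → ℕ) (x : Fin 4) → rank v x ℕ.< 4
rank<4 v x =
  count-mono-< {p = λ y → v y ℕ.<ᵇ v x} {q = λ _ → true} (λ _ _ → _) (∈-allFin x) (<ᵇ-irrefl (v x)) _

rank-<ᵇ : (v : Fin 4 → ℕ) (x y : Fin 4) → (v x ℕ.<ᵇ v y) ≡ (rank v x ℕ.<ᵇ rank v y)
rank-<ᵇ v x y = does-⇔ (mk⇔ to from) (v x ℕ.<? v y) (rank v x ℕ.<? rank v y)
  where
  to : v x ℕ.< v y → rank v x ℕ.< rank v y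
  to vx<vy = count-mono-< {p = λ z → v z ℕ.<ᵇ v x} (λ z h → ℕₚ.<⇒<ᵇ (ℕₚ.<-trans (ℕₚ.<ᵇ⇒< _ _ h) vx<vy))
                          (∈-allFin x) (<ᵇ-irrefl (v x)) (ℕₚ.<⇒<ᵇ vx<vy)
  from : rank v x ℕ.< rank v y → v x ℕ.< v y
  from rx<ry = ℕₚ.≰⇒> λ vy≤vx →
    ℕₚ.<⇒≱ rx<ry (count-mono {p = λ z → v z ℕ.<ᵇ v y} (λ z h → ℕₚ.<⇒<ᵇ (ℕₚ.<-≤-trans (ℕₚ.<ᵇ⇒< _ _ h) vy≤vx)) (allFin 4))

local-identity : (v : Fin 4 → ℕ) (s t : Bool) → LocalIdentity (orderOn ℕ._<ᵇ_ v) s t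
local-identity v s t =
  subst (λ table → LocalIdentity (lookupOrder table) s t) (tabulateOrder-cong same-order)
        (local-identity-on-ranks (r I) (r J) (r πI) (r πJ) s t)
  where
  r : Fin 4 → Fin 4
  r x = fromℕ< (rank<4 v x)
  same-order : ∀ x y → ltFin (r x) (r y) ≡ (v x ℕ.<ᵇ v y)
  same-order x y = trans (cong₂ ℕ._<ᵇ_ (Finₚ.toℕ-fromℕ< (rank<4 v x)) (Finₚ.toℕ-fromℕ< (rank<4 v y))) (sym (rank-<ᵇ v x y))

≤ᵇ≡not-<ᵇ : ∀ x y → x ≤ᵇ y ≡ not (y <ᵇ x)
≤ᵇ≡not-<ᵇ x y = begin
  isYes (x ≤? y)      ≡⟨ isYes≗does (x ≤? y) ⟩
  does (x ≤? y)       ≡⟨ does-⇔ (mk⇔ ℤₚ.≤⇒≯ ℤₚ.≮⇒≥) (x ≤? y) (¬? (y <? x)) ⟩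
  not (does (y <? x)) ≡⟨ cong not (isYes≗does (y <? x)) ⟨
  not (y <ᵇ x)        ∎

+-cancelˡ-<ᵇ : ∀ c x y → (c + x) <ᵇ (c + y) ≡ x <ᵇ y
+-cancelˡ-<ᵇ c x y = isYes-⇔ (mk⇔ cancel (ℤₚ.+-monoʳ-< c)) (c + x <? c + y) (x <? y)
  where
  undo : ∀ c z → - c + (c + z) ≡ z
  undo = solve-∀
  cancel : c + x < c + y → x < y
  cancel h = subst₂ _<_ (undo c x) (undo c y) (ℤₚ.+-monoʳ-< (- c) h)

appendBit : ℕ → Bool → ℕ
appendBit zero    false = 0
appendBit zero    true  = 1
appendBit (suc a) e     = suc (suc (appendBit a e))

appendBit≡ : ∀ a e → + appendBit a e ≡ + 2 * + a + 𝟙 e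
appendBit≡ zero    false = refl
appendBit≡ zero    true  = refl
appendBit≡ (suc a) e     = trans (cong (_+_ (+ 2)) (appendBit≡ a e)) (shift (+ a) (𝟙 e))
  where shift : ∀ a b → + 2 + (+ 2 * a + b) ≡ + 2 * (+ 1 + a) + b
        shift = solve-∀

appendBit-<ᵇ : ∀ a e b f → (appendBit a e ℕ.<ᵇ appendBit b f) ≡ ((a ℕ.<ᵇ b) ∨ (not (b ℕ.<ᵇ a) ∧ not e ∧ f))
appendBit-<ᵇ zero    false zero    false = refl
appendBit-<ᵇ zero    false zero    true  = refl
appendBit-<ᵇ zero    true  zero    false = refl
appendBit-<ᵇ zero    true  zero    true  = refl
appendBit-<ᵇ zero    false (suc b) f     = refl
appendBit-<ᵇ zero    true  (suc b) f     = refl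
appendBit-<ᵇ (suc a) e     zero    false = refl
appendBit-<ᵇ (suc a) e     zero    true  = refl
appendBit-<ᵇ (suc a) e     (suc b) f     = appendBit-<ᵇ a e b f

𝟙-not : ∀ e → 𝟙 (not e) ≡ + 1 - 𝟙 e
𝟙-not true  = refl
𝟙-not false = refl

vertexPosition : {n : ℕ} → Label n × Bool → ℤ
vertexPosition (l , e) = + 2 * pigIdx l + 𝟙 e

-- vertexPosition v - 2n, written in canonical form.
offset : {n : ℕ} → Label n × Bool → ℤ
offset ((true  , x) , e) = -[1+ appendBit (toℕ x) (not e) ]
offset ((false , x) , e) = + appendBit (toℕ x) e

module _ {n : ℕ} where
  open SignedOrder (ltFin {n})

  labelℤ-<ᵇ : (l l′ : Label n) → labelℤ l <ᵇ labelℤ l′ ≡ l ⊏ l′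
  labelℤ-<ᵇ (true  , x) (true  , y) = isYes≗does (labelℤ (true , x) <? labelℤ (true , y))
  labelℤ-<ᵇ (true  , x) (false , y) = refl
  labelℤ-<ᵇ (false , x) (true  , y) = refl
  labelℤ-<ᵇ (false , x) (false , y) = isYes≗does (pos x <? pos y)

  labelℤ-≤ᵇ : (l l′ : Label n) → labelℤ l ≤ᵇ labelℤ l′ ≡ l ⊑ l′
  labelℤ-≤ᵇ l l′ = trans (≤ᵇ≡not-<ᵇ (labelℤ l) (labelℤ l′)) (cong not (labelℤ-<ᵇ l′ l))

  -labelℤ : (s : Bool) (x : Fin n) → - labelℤ (s , x) ≡ labelℤ (not s , x)
  -labelℤ true  x = refl
  -labelℤ false x = refl

  firstV≡ : (l : Label n) → firstV l ≡ vertexPosition (l , proj₁ l)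
  firstV≡ (true  , x) = refl
  firstV≡ (false , x) = sym (ℤₚ.+-identityʳ _)

  secondV≡ : (l : Label n) → secondV l ≡ vertexPosition (l , not (proj₁ l))
  secondV≡ (true  , x) = sym (ℤₚ.+-identityʳ _)
  secondV≡ (false , x) = refl

  vertexPosition≡ : (v : Label n × Bool) → vertexPosition v ≡ + 2 * + n + offset v
  vertexPosition≡ ((true , x) , e) = begin
    + 2 * (- (+ 1 + + a) + + n) + 𝟙 e
      ≡⟨ shift (+ a) (+ n) (𝟙 e) ⟩
    + 2 * + n + - (+ 1 + (+ 2 * + a + (+ 1 - 𝟙 e)))
      ≡⟨ cong (λ k → + 2 * + n + - (+ 1 + k)) (trans (appendBit≡ a (not e)) (cong (_+_ (+ 2 * + a)) (𝟙-not e))) ⟨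
    + 2 * + n + -[1+ appendBit a (not e) ] ∎
    where
    a = toℕ x
    shift : ∀ a m b → + 2 * (- (+ 1 + a) + m) + b ≡ + 2 * m + - (+ 1 + (+ 2 * a + (+ 1 - b)))
    shift = solve-∀
  vertexPosition≡ ((false , x) , e) = trans (shift (+ a) (+ n) (𝟙 e)) (cong (_+_ (+ 2 * + n)) (sym (appendBit≡ a e)))
    where
    a = toℕ x
    shift : ∀ a m b → + 2 * ((+ 1 + a) + m - + 1) + b ≡ + 2 * m + (+ 2 * a + b)
    shift = solve-∀

  offset-<ᵇ : (v w : Label n × Bool) → offset v <ᵇ offset w ≡ v ◁ w
  offset-<ᵇ ((true , x) , e) ((true , y) , f) = begin
    offset ((true , x) , e) <ᵇ offset ((true , y) , f)
      ≡⟨ isYes≗does (offset ((true , x) , e) <? offset ((true , y) , f)) ⟩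
    appendBit b (not f) ℕ.<ᵇ appendBit a (not e)
      ≡⟨ appendBit-<ᵇ b (not f) a (not e) ⟩
    (b ℕ.<ᵇ a) ∨ (not (a ℕ.<ᵇ b) ∧ not (not f) ∧ not e)
      ≡⟨ cong (λ c → (b ℕ.<ᵇ a) ∨ (not (a ℕ.<ᵇ b) ∧ c)) (trans (cong (λ g → g ∧ not e) (not-involutive f)) (∧-comm f (not e))) ⟩
    (b ℕ.<ᵇ a) ∨ (not (a ℕ.<ᵇ b) ∧ not e ∧ f) ∎
    where a = toℕ x; b = toℕ y
  offset-<ᵇ ((true  , x) , e) ((false , y) , f) = refl
  offset-<ᵇ ((false , x) , e) ((true  , y) , f) = refl
  offset-<ᵇ ((false , x) , e) ((false , y) , f) =
    trans (isYes≗does (offset ((false , x) , e) <? offset ((false , y) , f))) (appendBit-<ᵇ (toℕ x) e (toℕ y) f)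

  vertexPosition-<ᵇ : (v w : Label n × Bool) → vertexPosition v <ᵇ vertexPosition w ≡ v ◁ w
  vertexPosition-<ᵇ v w = begin
    vertexPosition v <ᵇ vertexPosition w                ≡⟨ cong₂ _<ᵇ_ (vertexPosition≡ v) (vertexPosition≡ w) ⟩
    (+ 2 * + n + offset v) <ᵇ (+ 2 * + n + offset w)    ≡⟨ +-cancelˡ-<ᵇ (+ 2 * + n) (offset v) (offset w) ⟩
    offset v <ᵇ offset w                                ≡⟨ offset-<ᵇ v w ⟩
    v ◁ w                                               ∎

alignedPair : {n : ℕ} → SignedPerm n → Label n → Label n → Bool
alignedPair π l l′ = labelℤ l <ᵇ labelℤ l′ ∧ isAlignment (arcOf π l) (arcOf π l′)

pairAlignments : {n : ℕ} → SignedPerm n → Fin n → Fin n → ℤ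
pairAlignments π i j =
    (𝟙 (alignedPair π (true , i) (true , j)) + 𝟙 (alignedPair π (true , i) (false , j)))
  + (𝟙 (alignedPair π (false , i) (true , j)) + 𝟙 (alignedPair π (false , i) (false , j)))

pairWeight : {n : ℕ} → SignedPerm n → Fin n → Fin n → ℤ
pairWeight π i j = + 2 * 𝟙 (isCrossing π (i , j)) + pairAlignments π i j

==ᵇ-refl : ∀ b → T (b ==ᵇ b)
==ᵇ-refl true  = _
==ᵇ-refl false = _

tied-toℕ : {n : ℕ} (x y : Fin n) → not (ltFin x y ∨ ltFin y x) ≡ does (x ≟ y)
tied-toℕ x y = does-⇔ (mk⇔ to from) (¬? ((toℕ x ℕ.<? toℕ y) ⊎-dec (toℕ y ℕ.<? toℕ x))) (x ≟ y)
  where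
  to : ¬ (toℕ x ℕ.< toℕ y ⊎ toℕ y ℕ.< toℕ x) → x ≡ y
  to x≮≯y = Finₚ.toℕ-injective (ℕₚ.≤-antisym (ℕₚ.≮⇒≥ (x≮≯y ∘ inj₂)) (ℕₚ.≮⇒≥ (x≮≯y ∘ inj₁)))
  from : x ≡ y → ¬ (toℕ x ℕ.< toℕ y ⊎ toℕ y ℕ.< toℕ x)
  from refl = [ ℕₚ.<-irrefl refl , ℕₚ.<-irrefl refl ]

module _ {n : ℕ} (π : SignedPerm n) where
  open SignedOrder (ltFin {n})

  private
    σ : Fin n → Fin n
    σ i = perm π ⟨$⟩ʳ i
    sign : Fin n → Bool
    sign = negative π

  σ-injective : ∀ {i j} → σ i ≡ σ j → i ≡ j
  σ-injective {i} {j} σi≡σj = trans (sym (inverseˡ (perm π))) (trans (cong (perm π ⟨$⟩ˡ_) σi≡σj) (inverseˡ (perm π)))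

  pairPoint : Fin n → Fin n → Fin 4 → Fin n
  pairPoint i j = quad i j (σ i) (σ j)

  pairOrder : Fin n → Fin n → Order
  pairOrder i j = orderOn ltFin (pairPoint i j)

  isCrossing≡crossing : ∀ i j → isCrossing π (i , j) ≡ crossing (pairOrder i j) (sign i) (sign j)
  isCrossing≡crossing i j =
    cong₂ _∨_ (cong₂ _∧_ (lt +i +j) (cong₂ _∧_ (labelℤ-≤ᵇ +j πi) (lt πi πj)))
   (cong₂ _∨_ (cong₂ _∧_ (lt (true , i) +j)
                         (cong₂ _∧_ (trans (cong (λ z → pos j ≤ᵇ z) (-labelℤ (sign i) (σ i))) (labelℤ-≤ᵇ +j -πi))
                                    (trans (cong (λ z → z <ᵇ val π j) (-labelℤ (sign i) (σ i))) (lt -πi πj))))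
              (cong₂ _∧_ (lt +j +i) (cong₂ _∧_ (lt πi +j) (lt πj πi))))
    where
    lt = labelℤ-<ᵇ
    +i = (false , i)
    +j = (false , j)
    πi = (sign i , σ i)
    πj = (sign j , σ j)
    -πi = (not (sign i) , σ i)

  alignedPair≡aligned : ∀ i j ε δ → alignedPair π (ε , i) (δ , j) ≡ aligned (pairOrder i j) (sign i) (sign j) ε δ
  alignedPair≡aligned i j ε δ = cong₂ _∧_ (labelℤ-<ᵇ (ε , i) (δ , j)) (begin
    isAlignment (arcOf π (ε , i)) (arcOf π (δ , j))
      ≡⟨ cong₂ isAlignment (cong₂ arc (firstV≡ (ε , i)) (secondV≡ (ε xor sign i , σ i)))
                           (cong₂ arc (firstV≡ (δ , j)) (secondV≡ (δ xor sign j , σ j))) ⟩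
    isAlignmentBy _<ᵇ_ (position K₁ , position K₂) (position K₃ , position K₄)
      ≡⟨ isAlignmentBy≡alignment _<ᵇ_ (position K₁) (position K₂) (position K₃) (position K₄) ⟩
    alignment (orderOn _<ᵇ_ (position ∘ ends))
      ≡⟨ alignment-cong (λ x y → vertexPosition-<ᵇ (onPair (ends x)) (onPair (ends y))) ⟩
    alignment (orderOn (SignedOrder._◁_ (pairOrder i j)) ends) ∎)
    where
    onPair : (Bool × Fin 4) × Bool → (Bool × Fin n) × Bool
    onPair ((u , x) , e) = ((u , pairPoint i j x) , e)
    position : (Bool × Fin 4) × Bool → ℤ
    position = vertexPosition ∘ onPair
    K₁ K₂ K₃ K₄ : (Bool × Fin 4) × Bool
    K₁ = ((ε , I) , ε)
    K₂ = ((ε xor sign i , πI) , not (ε xor sign i))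
    K₃ = ((δ , J) , δ)
    K₄ = ((δ xor sign j , πJ) , not (δ xor sign j))
    ends : Fin 4 → (Bool × Fin 4) × Bool
    ends = quad K₁ K₂ K₃ K₄

  pairWeight≡weight : ∀ i j → pairWeight π i j ≡ weight (pairOrder i j) (sign i) (sign j)
  pairWeight≡weight i j =
    cong₂ (λ c a → + 2 * 𝟙 c + a) (isCrossing≡crossing i j)
      (cong₂ _+_ (cong₂ _+_ (aligned≡ true true) (aligned≡ true false)) (cong₂ _+_ (aligned≡ false true) (aligned≡ false false)))
    where aligned≡ = λ ε δ → cong 𝟙 (alignedPair≡aligned i j ε δ)

  admissible-pair : ∀ i j → T (admissible (pairOrder i j) (sign i) (sign j))
  admissible-pair i j rewrite tied-toℕ i j | tied-toℕ (σ i) (σ j) with i ≟ j | σ i ≟ σ j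
  ... | yes refl | yes _        = ==ᵇ-refl (sign i)
  ... | yes refl | no σi≢σi     = σi≢σi refl
  ... | no i≢j   | yes σi≡σj    = i≢j (σ-injective σi≡σj)
  ... | no _     | no _         = _

  pairWeight≡localWeight : ∀ i j → pairWeight π i j ≡ localWeight (pairOrder i j) (sign i) (sign j)
  pairWeight≡localWeight i j =
    trans (pairWeight≡weight i j) (local-identity (toℕ ∘ pairPoint i j) (sign i) (sign j) (admissible-pair i j))

  -- Summing over all pairs

  cro≡∑∑ : + cro π ≡ ∑[ i < n ] ∑[ j < n ] 𝟙 (isCrossing π (i , j))
  cro≡∑∑ = begin
    + cro π
      ≡⟨ count≡∑ₗ (isCrossing π) (pairs (allFin n)) ⟩
    ∑ₗ (pairs (allFin n)) (𝟙 ∘ isCrossing π)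
      ≡⟨ ∑ₗ-pairs (allFin n) (𝟙 ∘ isCrossing π) ⟩
    ∑ₗ (allFin n) (λ i → ∑ₗ (allFin n) (λ j → 𝟙 (isCrossing π (i , j))))
      ≡⟨ ∑ₗ-tabulate (λ i → i) (λ i → ∑ₗ (allFin n) (λ j → 𝟙 (isCrossing π (i , j)))) ⟩
    ∑[ i < n ] ∑ₗ (allFin n) (λ j → 𝟙 (isCrossing π (i , j)))
      ≡⟨ sum-cong-≗ (λ i → ∑ₗ-tabulate (λ j → j) (λ j → 𝟙 (isCrossing π (i , j)))) ⟩
    ∑[ i < n ] ∑[ j < n ] 𝟙 (isCrossing π (i , j)) ∎

  al≡∑∑ : + al π ≡ ∑[ i < n ] ∑[ j < n ] pairAlignments π i j
  al≡∑∑ = begin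
    + al π
      ≡⟨ count≡∑ₗ _ (pairs (labels n)) ⟩
    ∑ₗ (pairs (labels n)) (λ (l , l′) → 𝟙 (alignedPair π l l′))
      ≡⟨ ∑ₗ-pairs (labels n) _ ⟩
    ∑ₗ (labels n) (λ l → ∑ₗ (labels n) (λ l′ → 𝟙 (alignedPair π l l′)))
      ≡⟨ ∑ₗ-labels (λ l → ∑ₗ (labels n) (λ l′ → 𝟙 (alignedPair π l l′))) ⟩
    ∑[ i < n ] (∑ₗ (labels n) (λ l′ → 𝟙 (alignedPair π (true , i) l′)) + ∑ₗ (labels n) (λ l′ → 𝟙 (alignedPair π (false , i) l′)))
      ≡⟨ sum-cong-≗ (λ i → cong₂ _+_ (∑ₗ-labels (λ l′ → 𝟙 (alignedPair π (true , i) l′))) (∑ₗ-labels (λ l′ → 𝟙 (alignedPair π (false , i) l′)))) ⟩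
    ∑[ i < n ] (∑[ j < n ] with-sign true i j + ∑[ j < n ] with-sign false i j)
      ≡⟨ sum-cong-≗ (λ i → ∑-distrib-+ (with-sign true i) (with-sign false i)) ⟨
    ∑[ i < n ] ∑[ j < n ] pairAlignments π i j ∎
    where
    with-sign : Bool → Fin n → Fin n → ℤ
    with-sign ε i j = 𝟙 (alignedPair π (ε , i) (true , j)) + 𝟙 (alignedPair π (ε , i) (false , j))

  2cro+al≡∑∑pairWeight : + 2 * + cro π + + al π ≡ ∑[ i < n ] ∑[ j < n ] pairWeight π i j
  2cro+al≡∑∑pairWeight = begin
    + 2 * + cro π + + al π
      ≡⟨ cong₂ (λ c a → + 2 * c + a) cro≡∑∑ al≡∑∑ ⟩
    + 2 * (∑[ i < n ] ∑[ j < n ] crosses i j) + ∑[ i < n ] ∑[ j < n ] pairAlignments π i j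
      ≡⟨ ∑-scale-+ (+ 2) (λ i → ∑[ j < n ] crosses i j) (λ i → ∑[ j < n ] pairAlignments π i j) ⟨
    ∑[ i < n ] (+ 2 * (∑[ j < n ] crosses i j) + ∑[ j < n ] pairAlignments π i j)
      ≡⟨ sum-cong-≗ (λ i → ∑-scale-+ (+ 2) (crosses i) (pairAlignments π i)) ⟨
    ∑[ i < n ] ∑[ j < n ] pairWeight π i j ∎
    where
    crosses : Fin n → Fin n → ℤ
    crosses i j = 𝟙 (isCrossing π (i , j))

  weakExcedance : Fin n → Bool
  weakExcedance i = (false , i) ⊑ (sign i , σ i)

  wex≡∑ : + wex π ≡ ∑[ i < n ] 𝟙 (weakExcedance i)
  wex≡∑ = trans (count≡∑ₗ (λ i → pos i ≤ᵇ val π i) (allFin n))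
    (trans (∑ₗ-tabulate (λ i → i) (λ i → 𝟙 (pos i ≤ᵇ val π i))) (sum-cong-≗ (λ i → cong 𝟙 (labelℤ-≤ᵇ (false , i) (sign i , σ i)))))

  neg≡∑ : + neg π ≡ ∑[ i < n ] 𝟙 (sign i)
  neg≡∑ = trans (count≡∑ₗ sign (allFin n)) (∑ₗ-tabulate (λ i → i) (𝟙 ∘ sign))

  fwexTerm : Fin n → ℤ
  fwexTerm i = 𝟙 (not (sign i)) - + 2 * 𝟙 (not (sign i) ∧ ltFin (σ i) i)

  ∑-fwexTerm : ∑[ i < n ] fwexTerm i ≡ + 2 * + wex π + + neg π - + n
  ∑-fwexTerm = begin
    ∑[ i < n ] fwexTerm i
      ≡⟨ sum-cong-≗ (λ i → pointwise (sign i) (ltFin (σ i) i)) ⟩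
    ∑[ i < n ] (+ 2 * 𝟙 (weakExcedance i) + (𝟙 (sign i) + -1ℤ))
      ≡⟨ ∑-scale-+ (+ 2) (𝟙 ∘ weakExcedance) (λ i → 𝟙 (sign i) + -1ℤ) ⟩
    + 2 * (∑[ i < n ] 𝟙 (weakExcedance i)) + ∑[ i < n ] (𝟙 (sign i) + -1ℤ)
      ≡⟨ cong₂ (λ w z → + 2 * w + z) (sym wex≡∑) (∑-distrib-+ (𝟙 ∘ sign) (λ _ → -1ℤ)) ⟩
    + 2 * + wex π + (∑[ i < n ] 𝟙 (sign i) + ∑[ i < n ] -1ℤ)
      ≡⟨ cong₂ (λ g m → + 2 * + wex π + (g + m)) (sym neg≡∑) (∑-const n (-1ℤ)) ⟩
    + 2 * + wex π + (+ neg π + + n * -1ℤ)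
      ≡⟨ collect (+ wex π) (+ neg π) (+ n) ⟩
    + 2 * + wex π + + neg π - + n ∎
    where
    pointwise : ∀ s p → 𝟙 (not s) - + 2 * 𝟙 (not s ∧ p) ≡ + 2 * 𝟙 (not (if s then true else p)) + (𝟙 s + -1ℤ)
    pointwise true  _     = refl
    pointwise false true  = refl
    pointwise false false = refl
    collect : ∀ w g m → + 2 * w + (g + m * -1ℤ) ≡ + 2 * w + g - m
    collect = solve-∀

  ∑-rowTerm : ∀ i → ∑[ j < n ] rowTerm (pairOrder i j) (sign i) ≡ + 2 * + toℕ i - + toℕ (σ i) + fwexTerm i
  ∑-rowTerm i = begin
    ∑[ j < n ] rowTerm (pairOrder i j) (sign i)
      ≡⟨ sum-cong-≗ (λ j → regroup (u j) (v j) (w j) (x j) N D) ⟩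
    ∑[ j < n ] ((α * u j + β * v j) + (γ * w j + δ * x j))
      ≡⟨ ∑-distrib-+ (λ j → α * u j + β * v j) (λ j → γ * w j + δ * x j) ⟩
    ∑[ j < n ] (α * u j + β * v j) + ∑[ j < n ] (γ * w j + δ * x j)
      ≡⟨ cong₂ _+_ (∑-linear α β u v) (∑-linear γ δ w x) ⟩
    (α * sum u + β * sum v) + (γ * sum w + δ * sum x)
      ≡⟨ cong₂ _+_ (cong₂ (λ U V → α * U + β * V) (∑-below a (ℕₚ.<⇒≤ a<n)) (∑-below-permuted (perm π) c (ℕₚ.<⇒≤ c<n)))
                   (cong₂ (λ W X → γ * W + δ * X) (∑-atMost a a<n) (∑-atMost c c<n)) ⟩
    (α * + a + β * + c) + (γ * + suc a + δ * + suc c)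
      ≡⟨ collect (+ a) (+ c) N D ⟩
    + 2 * + a - + c + (N - D) ∎
    where
    a = toℕ i
    c = toℕ (σ i)
    a<n = Finₚ.toℕ<n i
    c<n = Finₚ.toℕ<n (σ i)
    N = 𝟙 (not (sign i))
    D = + 2 * 𝟙 (not (sign i) ∧ ltFin (σ i) i)
    α = + 2 - N
    β = D - + 1
    γ = N
    δ = - D
    u v w x : Fin n → ℤ
    u j = 𝟙 (toℕ j ℕ.<ᵇ a)
    v j = 𝟙 (toℕ (σ j) ℕ.<ᵇ c)
    w j = 𝟙 (not (a ℕ.<ᵇ toℕ j))
    x j = 𝟙 (not (c ℕ.<ᵇ toℕ j))
    regroup : ∀ u v w x N D → + 2 * u - v + N * (w - u) + D * (v - x) ≡ ((+ 2 - N) * u + (D - + 1) * v) + (N * w + (- D) * x)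
    regroup = solve-∀
    collect : ∀ a c N D → ((+ 2 - N) * a + (D - + 1) * c) + (N * (+ 1 + a) + (- D) * (+ 1 + c)) ≡ + 2 * a - c + (N - D)
    collect = solve-∀

  ∑-colTerm : ∀ j → ∑[ i < n ] colTerm (pairOrder i j) (sign j) ≡ + toℕ j
  ∑-colTerm j = begin
    ∑[ i < n ] colTerm (pairOrder i j) (sign j)
      ≡⟨ sum-cong-≗ (λ i → regroup (u i) (v i) W) ⟩
    ∑[ i < n ] ((+ 1 + W) * u i + (- W) * v i)
      ≡⟨ ∑-linear (+ 1 + W) (- W) u v ⟩
    (+ 1 + W) * sum u + (- W) * sum v
      ≡⟨ cong₂ (λ U V → (+ 1 + W) * U + (- W) * V) (∑-below b b≤n) (∑-below-permuted (perm π) b b≤n) ⟩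
    (+ 1 + W) * + b + (- W) * + b
      ≡⟨ collect (+ b) W ⟩
    + b ∎
    where
    b = toℕ j
    b≤n = ℕₚ.<⇒≤ (Finₚ.toℕ<n j)
    W = + 2 * 𝟙 (not (sign j) ∧ not (ltFin (σ j) j))
    u v : Fin n → ℤ
    u i = 𝟙 (toℕ i ℕ.<ᵇ b)
    v i = 𝟙 (toℕ (σ i) ℕ.<ᵇ b)
    regroup : ∀ u v W → u + W * (u - v) ≡ (+ 1 + W) * u + (- W) * v
    regroup = solve-∀
    collect : ∀ b W → (+ 1 + W) * b + (- W) * b ≡ b
    collect = solve-∀

  ∑∑localWeight : ∑[ i < n ] ∑[ j < n ] localWeight (pairOrder i j) (sign i) (sign j)
                ≡ + n * + n - + 2 * + n + (+ 2 * + wex π + + neg π)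
  ∑∑localWeight = begin
    ∑[ i < n ] ∑[ j < n ] (row i j + col i j)
      ≡⟨ sum-cong-≗ (λ i → ∑-distrib-+ (row i) (col i)) ⟩
    ∑[ i < n ] (∑[ j < n ] row i j + ∑[ j < n ] col i j)
      ≡⟨ ∑-distrib-+ (λ i → ∑[ j < n ] row i j) (λ i → ∑[ j < n ] col i j) ⟩
    ∑[ i < n ] ∑[ j < n ] row i j + ∑[ i < n ] ∑[ j < n ] col i j
      ≡⟨ cong₂ _+_ (sum-cong-≗ ∑-rowTerm) (trans (∑-comm col) (sum-cong-≗ ∑-colTerm)) ⟩
    ∑[ i < n ] (+ 2 * a i - c i + fwexTerm i) + ∑[ i < n ] a i
      ≡⟨ ∑-distrib-+ (λ i → + 2 * a i - c i + fwexTerm i) a ⟨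
    ∑[ i < n ] (+ 2 * a i - c i + fwexTerm i + a i)
      ≡⟨ sum-cong-≗ (λ i → regroup (a i) (c i) (fwexTerm i)) ⟩
    ∑[ i < n ] ((+ 3 * a i + -1ℤ * c i) + fwexTerm i)
      ≡⟨ ∑-distrib-+ (λ i → + 3 * a i + -1ℤ * c i) fwexTerm ⟩
    ∑[ i < n ] (+ 3 * a i + -1ℤ * c i) + ∑[ i < n ] fwexTerm i
      ≡⟨ cong₂ _+_ (∑-linear (+ 3) -1ℤ a c) ∑-fwexTerm ⟩
    + 3 * sum a + -1ℤ * sum c + (+ 2 * + wex π + + neg π - + n)
      ≡⟨ cong (λ z → + 3 * sum a + -1ℤ * z + (+ 2 * + wex π + + neg π - + n)) (∑-permute a (perm π)) ⟨
    + 3 * sum a + -1ℤ * sum a + (+ 2 * + wex π + + neg π - + n)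
      ≡⟨ collect (sum a) (+ n) (+ 2 * + wex π + + neg π) (double-∑-toℕ n) ⟩
    + n * + n - + 2 * + n + (+ 2 * + wex π + + neg π) ∎
    where
    row col : Fin n → Fin n → ℤ
    row i j = rowTerm (pairOrder i j) (sign i)
    col i j = colTerm (pairOrder i j) (sign j)
    a c : Fin n → ℤ
    a i = + toℕ i
    c i = + toℕ (σ i)
    regroup : ∀ a c f → + 2 * a - c + f + a ≡ (+ 3 * a + -1ℤ * c) + f
    regroup = solve-∀
    collect : ∀ X m k → + 2 * X ≡ m * m - m → + 3 * X + -1ℤ * X + (k - m) ≡ m * m - + 2 * m + k
    collect X m k 2X≡ = trans (shuffle X m k) (trans (cong (λ z → z + (k - m)) 2X≡) (finish m k))
      where
      shuffle : ∀ X m k → + 3 * X + -1ℤ * X + (k - m) ≡ + 2 * X + (k - m)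
      shuffle = solve-∀
      finish : ∀ m k → m * m - m + (k - m) ≡ m * m - + 2 * m + k
      finish = solve-∀

proposition1p5 : (n : ℕ) (π : SignedPerm n) (k : ℕ) → fwex π ≡ k →
    + 2 * + cro π + + al π ≡ + n * + n - + 2 * + n + + k
proposition1p5 n π k refl = begin
  + 2 * + cro π + + al π
    ≡⟨ 2cro+al≡∑∑pairWeight π ⟩
  ∑[ i < n ] ∑[ j < n ] pairWeight π i j
    ≡⟨ sum-cong-≗ (λ i → sum-cong-≗ (pairWeight≡localWeight π i)) ⟩
  ∑[ i < n ] ∑[ j < n ] localWeight (pairOrder π i j) (negative π i) (negative π j)
    ≡⟨ ∑∑localWeight π ⟩
  + n * + n - + 2 * + n + (+ 2 * + wex π + + neg π)
    ≡⟨ cong (λ w → + n * + n - + 2 * + n + (w + + neg π)) (ℤₚ.pos-* 2 (wex π)) ⟨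
  + n * + n - + 2 * + n + + fwex π ∎
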